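{- Let $p$ be an even positive integer, $\mu=\frac{p^2}{4}+2p+2$, $\gamma=2\mu-\left(\frac{p}{2}+4\right)$ and $S(p)=\langle \mu,\gamma,\gamma+1\rangle_{p\mu}$. Then the number of left elements of $S(p)$ is $$|L(S(p))|=\frac{p^3}{24}+\frac{3}{8}p^2+\frac{13}{12}p.$$
   Context: A numerical semigroup is a submonoid of $(\mathbb N,+)$ with finite complement. For integers $a_1,\dots,a_r$ and $t$, $\langle a_1,\dots,a_r\rangle_t$ denotes the smallest numerical semigroup containing $a_1,\dots,a_r$ and all integers $\ge t$. The conductor $c(S)$ of a numerical semigroup $S$ is the smallest integer such that all integers $\ge c(S)$ belong to $S$, and $L(S)=\{s\in S: s<c(S)\}$ is the set of left elements of $S$. -}

module Defs where

open import Data.Nat using (ℕ; zero; suc; _+_; _*_; _∸_; _≤_; _<_)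
open import Data.List using (List; _∷_; []; length)
open import Data.List.Membership.Propositional using (_∈_)
open import Data.List.Relation.Unary.Unique.Propositional using (Unique)
open import Data.Sum using (_⊎_)
open import Data.Product using (_×_; Σ)
open import Function.Bundles using (_⇔_)

data InMonoid (gs : List ℕ) : ℕ → Set where
  mon-zero : InMonoid gs 0
  mon-step : ∀ {a n} → a ∈ gs → InMonoid gs n → InMonoid gs (a + n)

-- ⟨ gs ⟩_t : the smallest numerical semigroup containing gs and all integers ≥ t.
-- Any sum involving an integer ≥ t is itself ≥ t, so it is
-- { n | t ≤ n } ∪ ⟨ gs ⟩.
InGenT : List ℕ → ℕ → ℕ → Set
InGenT gs t n = t ≤ n ⊎ InMonoid gs n

IsConductor : (ℕ → Set) → ℕ → Set
IsConductor S c =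
  (∀ n → c ≤ n → S n) × (∀ c' → (∀ n → c' ≤ n → S n) → c ≤ c')

IsLeft : (ℕ → Set) → ℕ → ℕ → Set
IsLeft S c s = S s × s < c

HasCard : (ℕ → Set) → ℕ → Set
HasCard P N = Σ (List ℕ) λ xs → Unique xs × (∀ n → (n ∈ xs) ⇔ P n) × (length xs ≡' N)
  where
  open import Relation.Binary.PropositionalEquality using () renaming (_≡_ to _≡'_)

-- Data for S(p), p = 2k:  μ = p²/4 + 2p + 2 = k² + 2p + 2,  γ = 2μ − (p/2 + 4).
μ' : ℕ → ℕ → ℕ
μ' p k = k * k + 2 * p + 2

γ' : ℕ → ℕ → ℕ
γ' p k = 2 * μ' p k ∸ (k + 4)

InSp : ℕ → ℕ → ℕ → Set
InSp p k = InGenT (μ' p k ∷ γ' p k ∷ suc (γ' p k) ∷ []) (p * μ' p k)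

-- A number n lies in ⟨m, g, g + 1⟩ iff n = a m + j g + e with e ≤ j, i.e. iff it
-- lies in one of the blocks [a m + j g, a m + j g + j]. Since d = 2 m − g is small
-- (d = p/2 + 4 while m > (p/2) d), trading two m's for one g moves a block only
-- slightly down, and the blocks below p m are disjoint and occur in increasing
-- order of a + 2 j, and for equal a + 2 j in decreasing order of j. Those below
-- p m are exactly the blocks with a + 2 j < p, together with those with
-- a + 2 j = p and j ≥ 1; listed in this order they enumerate the left elements
-- strictly increasingly. The largest one is (p − 2) m + g + 1 < p m − 1, so
-- p m − 1 is a gap and p m is the conductor, and adding up the block sizes
-- j + 1 gives k (k + 1) (k + 2) / 3 + k (k + 3) / 2 left elements for p = 2 k.

module Submission where

open import Data.List using (List; []; _∷_; _++_; length; applyUpTo)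
open import Data.List.Properties using (length-++; length-applyUpTo; ++-identityʳ)
open import Data.List.Membership.Propositional using (_∈_)
open import Data.List.Membership.Propositional.Properties
  using (∈-++⁺ˡ; ∈-++⁺ʳ; ∈-applyUpTo⁺)
open import Data.List.Relation.Unary.All as All using (All)
import Data.List.Relation.Unary.All.Properties as Allₚ
open import Data.List.Relation.Unary.AllPairs as AllPairs using (AllPairs)
import Data.List.Relation.Unary.AllPairs.Properties as AllPairsₚ
open import Data.List.Relation.Unary.Any using (here; there)
open import Data.Nat
open import Data.Nat.DivMod using (_/_; _%_; m≡m%n+[m/n]*n; m%n<n)
open import Data.Nat.Properties
open import Data.Nat.Tactic.RingSolver using (solve)
open import Data.Empty using (⊥-elim)
open import Data.Product using (Σ; ∃; _×_; _,_; proj₁; proj₂)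
open import Data.Sum using (inj₁; inj₂)
open import Function.Bundles using (mk⇔)
open import Relation.Binary.PropositionalEquality
open import Relation.Nullary using (¬_; yes; no)

open import Defs

open import Algebra.Properties.CommutativeSemigroup +-commutativeSemigroup using (interchange)

generators : ℕ → ℕ → List ℕ
generators m g = m ∷ g ∷ suc g ∷ []

InMonoid-+ : ∀ {gs x y} → InMonoid gs x → InMonoid gs y → InMonoid gs (x + y)
InMonoid-+ mon-zero y∈ = y∈
InMonoid-+ {y = y} (mon-step {a} {n} a∈gs n∈) y∈ =
  subst (InMonoid _) (sym (+-assoc a n y)) (mon-step a∈gs (InMonoid-+ n∈ y∈))

InMonoid-* : ∀ {gs a} n → a ∈ gs → InMonoid gs (n * a)
InMonoid-* zero    a∈gs = mon-zero
InMonoid-* (suc n) a∈gs = mon-step a∈gs (InMonoid-* n a∈gs)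

record Decomposition (m g n : ℕ) : Set where
  constructor decomposition
  field
    a j e : ℕ
    e≤j   : e ≤ j
    n≡    : n ≡ a * m + j * g + e

Decomposition-+ : ∀ {m g x y} → Decomposition m g x → Decomposition m g y → Decomposition m g (x + y)
Decomposition-+ {m} {g} (decomposition a j e e≤j refl) (decomposition a′ j′ e′ e′≤j′ refl) =
  decomposition (a + a′) (j + j′) (e + e′) (+-mono-≤ e≤j e′≤j′) (begin
    a * m + j * g + e + (a′ * m + j′ * g + e′)
      ≡⟨ interchange (a * m + j * g) e (a′ * m + j′ * g) e′ ⟩
    a * m + j * g + (a′ * m + j′ * g) + (e + e′)
      ≡⟨ cong (_+ (e + e′)) (interchange (a * m) (j * g) (a′ * m) (j′ * g)) ⟩
    a * m + a′ * m + (j * g + j′ * g) + (e + e′)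
      ≡⟨ cong₂ (λ x y → x + y + (e + e′)) (*-distribʳ-+ m a a′) (*-distribʳ-+ g j j′) ⟨
    (a + a′) * m + (j + j′) * g + (e + e′) ∎)
  where open ≡-Reasoning

generator-decomposition : ∀ {m g x} → x ∈ generators m g → Decomposition m g x
generator-decomposition {m} {g} (here refl)                 = decomposition 1 0 0 z≤n m≡1m
  where
  m≡1m : m ≡ 1 * m + 0 * g + 0
  m≡1m = solve (m ∷ g ∷ [])
generator-decomposition {m} {g} (there (here refl))         = decomposition 0 1 0 z≤n g≡1g
  where
  g≡1g : g ≡ 0 * m + 1 * g + 0
  g≡1g = solve (m ∷ g ∷ [])
generator-decomposition {m} {g} (there (there (here refl))) = decomposition 0 1 1 (s≤s z≤n) 1+g≡1g+1
  where
  1+g≡1g+1 : suc g ≡ 0 * m + 1 * g + 1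
  1+g≡1g+1 = solve (m ∷ g ∷ [])

InMonoid⇒Decomposition : ∀ {m g n} → InMonoid (generators m g) n → Decomposition m g n
InMonoid⇒Decomposition mon-zero           = decomposition 0 0 0 z≤n refl
InMonoid⇒Decomposition (mon-step x∈gs n∈) =
  Decomposition-+ (generator-decomposition x∈gs) (InMonoid⇒Decomposition n∈)

Decomposition⇒InMonoid : ∀ {m g n} → Decomposition m g n → InMonoid (generators m g) n
Decomposition⇒InMonoid {m} {g} (decomposition a j e e≤j refl) with m≤n⇒∃[o]m+o≡n e≤j
... | f , refl = subst (InMonoid _) regroup
  (InMonoid-+ (InMonoid-* a (here refl))
    (InMonoid-+ (InMonoid-* f (there (here refl))) (InMonoid-* e (there (there (here refl))))))
  where
  regroup : a * m + (f * g + e * suc g) ≡ a * m + (e + f) * g + e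
  regroup = solve (a ∷ m ∷ f ∷ g ∷ e ∷ [])

InRange : ℕ → ℕ → ℕ → Set
InRange lo hi x = lo ≤ x × x < hi

IncreasingIn : ℕ → ℕ → List ℕ → Set
IncreasingIn lo hi xs = AllPairs _<_ xs × All (InRange lo hi) xs

increasingIn-widen : ∀ {lo lo′ hi hi′ xs} → lo′ ≤ lo → hi ≤ hi′ →
                     IncreasingIn lo hi xs → IncreasingIn lo′ hi′ xs
increasingIn-widen lo′≤lo hi≤hi′ (sorted , inRange) =
  sorted , All.map (λ (lo≤x , x<hi) → ≤-trans lo′≤lo lo≤x , <-≤-trans x<hi hi≤hi′) inRange

increasingIn-++ : ∀ {lo mid hi xs ys} → lo ≤ mid → mid ≤ hi →
                  IncreasingIn lo mid xs → IncreasingIn mid hi ys → IncreasingIn lo hi (xs ++ ys)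
increasingIn-++ lo≤mid mid≤hi (xs-sorted , xs-in) (ys-sorted , ys-in) =
  AllPairsₚ.++⁺ xs-sorted ys-sorted
    (All.map (λ (_ , x<mid) → All.map (λ (mid≤y , _) → <-≤-trans x<mid mid≤y) ys-in) xs-in) ,
  Allₚ.++⁺ (proj₂ (increasingIn-widen ≤-refl mid≤hi (xs-sorted , xs-in)))
           (proj₂ (increasingIn-widen lo≤mid ≤-refl (ys-sorted , ys-in)))

increasingIn-bounds : ∀ {lo hi x xs} → IncreasingIn lo hi (x ∷ xs) → lo ≤ hi
increasingIn-bounds (_ , (lo≤x , x<hi) All.∷ _) = ≤-trans lo≤x (<⇒≤ x<hi)

interval-increasing : ∀ b n → IncreasingIn b (b + n) (applyUpTo (b +_) n)
interval-increasing b n =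
  AllPairsₚ.applyUpTo⁺₁ (b +_) n (λ i<j _ → +-monoʳ-< b i<j) ,
  Allₚ.applyUpTo⁺₁ (b +_) n (λ i<n → m≤m+n b _ , +-monoʳ-< b i<n)

-- block a j lists the a m + j g + e with e ≤ j; diagonal a s lists the blocks
-- (a + 2 u, s − u) for u ≤ s, and levels q all blocks (a, j) with a + 2 j < 2 q.
module Staircase (m g : ℕ) where
  open ≡-Reasoning

  block : ℕ → ℕ → List ℕ
  block a j = applyUpTo (a * m + j * g +_) (suc j)

  stairs : ℕ → ℕ → List ℕ
  stairs a zero    = []
  stairs a (suc j) = block a (suc j) ++ stairs (2 + a) j

  diagonal : ℕ → ℕ → List ℕ
  diagonal a j = stairs a j ++ block (a + 2 * j) 0

  levels : ℕ → List ℕ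
  levels zero    = []
  levels (suc q) = levels q ++ (diagonal 0 q ++ diagonal 1 q)

  block-decomposed : ∀ a j → All (Decomposition m g) (block a j)
  block-decomposed a j =
    Allₚ.applyUpTo⁺₁ _ (suc j) (λ e<1+j → decomposition a j _ (s≤s⁻¹ e<1+j) refl)

  stairs-decomposed : ∀ a j → All (Decomposition m g) (stairs a j)
  stairs-decomposed a zero    = All.[]
  stairs-decomposed a (suc j) = Allₚ.++⁺ (block-decomposed a (suc j)) (stairs-decomposed (2 + a) j)

  diagonal-decomposed : ∀ a j → All (Decomposition m g) (diagonal a j)
  diagonal-decomposed a j = Allₚ.++⁺ (stairs-decomposed a j) (block-decomposed (a + 2 * j) 0)

  levels-decomposed : ∀ q → All (Decomposition m g) (levels q)
  levels-decomposed zero    = All.[]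
  levels-decomposed (suc q) =
    Allₚ.++⁺ (levels-decomposed q) (Allₚ.++⁺ (diagonal-decomposed 0 q) (diagonal-decomposed 1 q))

  ∈-block : ∀ a j {e} → e ≤ j → a * m + j * g + e ∈ block a j
  ∈-block a j e≤j = ∈-applyUpTo⁺ (a * m + j * g +_) (s≤s e≤j)

  ∈-stairs : ∀ a u {j e} → e ≤ suc j → (a + 2 * u) * m + suc j * g + e ∈ stairs a (u + suc j)
  ∈-stairs a zero {j} e≤j rewrite +-identityʳ a = ∈-++⁺ˡ (∈-block a (suc j) e≤j)
  ∈-stairs a (suc u) {j} {e} e≤j =
    ∈-++⁺ʳ (block a _) (subst (λ b → b * m + suc j * g + e ∈ stairs (2 + a) (u + suc j))
                              shift (∈-stairs (2 + a) u e≤j))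
    where
    shift : 2 + a + 2 * u ≡ a + 2 * suc u
    shift = solve (a ∷ u ∷ [])

  ∈-diagonal : ∀ a u {j e} → e ≤ j → (a + 2 * u) * m + j * g + e ∈ diagonal a (u + j)
  ∈-diagonal a u {suc j} e≤j = ∈-++⁺ˡ (∈-stairs a u e≤j)
  ∈-diagonal a u {zero} z≤n =
    subst (λ s → (a + 2 * u) * m + 0 * g + 0 ∈ diagonal a s) (sym (+-identityʳ u))
      (∈-++⁺ʳ (stairs a u) (∈-block (a + 2 * u) 0 z≤n))

  ∈-levels : ∀ q {r} u j {e} → r ≤ 1 → e ≤ j → u + j < q →
             (r + 2 * u) * m + j * g + e ∈ levels q
  ∈-levels (suc q) u j r≤1 e≤j (s≤s u+j≤q) with m≤n⇒m<n∨m≡n u+j≤q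
  ... | inj₁ u+j<q = ∈-++⁺ˡ (∈-levels q u j r≤1 e≤j u+j<q)
  ∈-levels (suc q) u j z≤n e≤j _ | inj₂ refl =
    ∈-++⁺ʳ (levels q) (∈-++⁺ˡ (∈-diagonal 0 u e≤j))
  ∈-levels (suc q) u j (s≤s z≤n) e≤j _ | inj₂ refl =
    ∈-++⁺ʳ (levels q) (∈-++⁺ʳ (diagonal 0 q) (∈-diagonal 1 u e≤j))

  stairs-length : ∀ a j → 2 * length (stairs a j) ≡ j * (3 + j)
  stairs-length a zero    = refl
  stairs-length a (suc j) = begin
    2 * length (block a (suc j) ++ stairs (2 + a) j)
      ≡⟨ cong (2 *_) (length-++ (block a (suc j))) ⟩
    2 * (length (block a (suc j)) + length (stairs (2 + a) j))
      ≡⟨ cong (λ l → 2 * (l + length (stairs (2 + a) j)))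
              (length-applyUpTo (a * m + suc j * g +_) (2 + j)) ⟩
    2 * (2 + j + length (stairs (2 + a) j))
      ≡⟨ *-distribˡ-+ 2 (2 + j) _ ⟩
    2 * (2 + j) + 2 * length (stairs (2 + a) j)
      ≡⟨ cong (2 * (2 + j) +_) (stairs-length (2 + a) j) ⟩
    2 * (2 + j) + j * (3 + j)
      ≡⟨ solve (j ∷ []) ⟩
    suc j * (3 + suc j) ∎

  diagonal-length : ∀ a j → 2 * length (diagonal a j) ≡ (1 + j) * (2 + j)
  diagonal-length a j = begin
    2 * length (stairs a j ++ block (a + 2 * j) 0)
      ≡⟨ cong (2 *_) (length-++ (stairs a j)) ⟩
    2 * (length (stairs a j) + 1)
      ≡⟨ *-distribˡ-+ 2 (length (stairs a j)) 1 ⟩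
    2 * length (stairs a j) + 2
      ≡⟨ cong (_+ 2) (stairs-length a j) ⟩
    j * (3 + j) + 2
      ≡⟨ solve (j ∷ []) ⟩
    (1 + j) * (2 + j) ∎

  levels-length : ∀ q → 3 * length (levels q) ≡ q * (1 + q) * (2 + q)
  levels-length zero    = refl
  levels-length (suc q) = begin
    3 * length (levels q ++ (diagonal 0 q ++ diagonal 1 q))
      ≡⟨ cong (3 *_) (length-++ (levels q)) ⟩
    3 * (length (levels q) + length (diagonal 0 q ++ diagonal 1 q))
      ≡⟨ *-distribˡ-+ 3 (length (levels q)) _ ⟩
    3 * length (levels q) + 3 * length (diagonal 0 q ++ diagonal 1 q)
      ≡⟨ cong₂ (λ x y → x + 3 * y) (levels-length q) diagonals-length ⟩
    q * (1 + q) * (2 + q) + 3 * ((1 + q) * (2 + q))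
      ≡⟨ solve (q ∷ []) ⟩
    suc q * (1 + suc q) * (2 + suc q) ∎
    where
    diagonals-length : length (diagonal 0 q ++ diagonal 1 q) ≡ (1 + q) * (2 + q)
    diagonals-length = *-cancelˡ-≡ _ _ 2 (begin
      2 * length (diagonal 0 q ++ diagonal 1 q)
        ≡⟨ cong (2 *_) (length-++ (diagonal 0 q)) ⟩
      2 * (length (diagonal 0 q) + length (diagonal 1 q))
        ≡⟨ *-distribˡ-+ 2 (length (diagonal 0 q)) _ ⟩
      2 * length (diagonal 0 q) + 2 * length (diagonal 1 q)
        ≡⟨ cong₂ _+_ (diagonal-length 0 q) (diagonal-length 1 q) ⟩
      (1 + q) * (2 + q) + (1 + q) * (2 + q)
        ≡⟨ solve (q ∷ []) ⟩
      2 * ((1 + q) * (2 + q)) ∎)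

-- d = 2 m − g, stated without truncated subtraction.
module Interleaving {m g d : ℕ} (g+d≡2m : g + d ≡ 2 * m) where
  open Staircase m g

  trade : ∀ x s → (x + 2 * s) * m ≡ x * m + s * g + s * d
  trade x s = begin
    (x + 2 * s) * m      ≡⟨ solve (x ∷ s ∷ m ∷ []) ⟩
    x * m + s * (2 * m)  ≡⟨ cong (λ y → x * m + s * y) (sym g+d≡2m) ⟩
    x * m + s * (g + d)  ≡⟨ solve (x ∷ m ∷ s ∷ g ∷ d ∷ []) ⟩
    x * m + s * g + s * d ∎
    where open ≡-Reasoning

  trade-upper : ∀ x s → x * m + s * g ≤ (x + 2 * s) * m
  trade-upper x s = ≤-trans (m≤m+n _ (s * d)) (≤-reflexive (sym (trade x s)))

  trade-split : ∀ x s y w → x + 2 * s ≡ y + w → y * m + w * m ≡ x * m + s * g + s * d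
  trade-split x s y w eq = begin
    y * m + w * m    ≡⟨ *-distribʳ-+ m y w ⟨
    (y + w) * m      ≡⟨ cong (_* m) eq ⟨
    (x + 2 * s) * m  ≡⟨ trade x s ⟩
    x * m + s * g + s * d ∎
    where open ≡-Reasoning

  trade-lower : ∀ x s y w → x + 2 * s ≡ y + w → s * d ≤ w * m → y * m ≤ x * m + s * g
  trade-lower x s y w eq sd≤wm = +-cancelʳ-≤ (w * m) _ _ (begin
    y * m + w * m          ≡⟨ trade-split x s y w eq ⟩
    x * m + s * g + s * d  ≤⟨ +-monoʳ-≤ _ sd≤wm ⟩
    x * m + s * g + w * m  ∎)
    where open ≤-Reasoning

  trade-lower-strict : ∀ x s y w → x + 2 * s ≡ y + w → s * d < w * m → y * m < x * m + s * g
  trade-lower-strict x s y w eq sd<wm = +-cancelʳ-< (w * m) _ _ (begin-strict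
    y * m + w * m          ≡⟨ trade-split x s y w eq ⟩
    x * m + s * g + s * d  <⟨ +-monoʳ-< _ sd<wm ⟩
    x * m + s * g + w * m  ∎)
    where open ≤-Reasoning

  block-gap : ∀ a j {e} → e ≤ d → a * m + suc j * g + e ≤ (2 + a) * m + j * g
  block-gap a j {e} e≤d = begin
    a * m + suc j * g + e               ≤⟨ +-monoʳ-≤ _ e≤d ⟩
    a * m + suc j * g + d               ≡⟨ solve (a ∷ m ∷ j ∷ g ∷ d ∷ []) ⟩
    a * m + 1 * g + 1 * d + j * g       ≡⟨ cong (_+ j * g) (trade a 1) ⟨
    (a + 2 * 1) * m + j * g             ≡⟨ solve (a ∷ m ∷ j ∷ g ∷ []) ⟩
    (2 + a) * m + j * g                 ∎
    where open ≤-Reasoning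

  block-increasing : ∀ a j → IncreasingIn (a * m + j * g) (a * m + j * g + suc j) (block a j)
  block-increasing a j = interval-increasing (a * m + j * g) (suc j)

  stairs-increasing : ∀ a j → 2 + j ≤ d →
    IncreasingIn (a * m + suc j * g) ((a + 2 * j) * m + g + 2) (stairs a (suc j))
  stairs-increasing a zero _ =
    subst (IncreasingIn _ _) (sym (++-identityʳ (block a 1)))
      (increasingIn-widen ≤-refl (≤-reflexive end) (block-increasing a 1))
    where
    end : a * m + 1 * g + 2 ≡ (a + 2 * 0) * m + g + 2
    end = solve (a ∷ m ∷ g ∷ [])
  stairs-increasing a (suc j) 3+j≤d =
    increasingIn-++ (≤-trans (m≤m+n _ _) top-block≤rest) (increasingIn-bounds rest)
      (increasingIn-widen ≤-refl top-block≤rest (block-increasing a (2 + j))) rest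
    where
    top-block≤rest : a * m + suc (suc j) * g + (3 + j) ≤ (2 + a) * m + suc j * g
    top-block≤rest = block-gap a (suc j) 3+j≤d
    end : (2 + a + 2 * j) * m + g + 2 ≡ (a + 2 * suc j) * m + g + 2
    end = solve (a ∷ j ∷ m ∷ g ∷ [])
    rest : IncreasingIn ((2 + a) * m + suc j * g) ((a + 2 * suc j) * m + g + 2)
                        (stairs (2 + a) (suc j))
    rest = increasingIn-widen ≤-refl (≤-reflexive end)
             (stairs-increasing (2 + a) j (≤-trans (n≤1+n _) 3+j≤d))

  point-increasing : ∀ b → IncreasingIn (b * m) (suc (b * m)) (block b 0)
  point-increasing b =
    increasingIn-widen (≤-reflexive (sym (+-identityʳ (b * m))))
      (≤-reflexive (trans (+-comm (b * m + 0) 1) (cong suc (+-identityʳ (b * m)))))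
      (block-increasing b 0)

  diagonal-increasing : ∀ a j → 2 + j ≤ d →
    IncreasingIn (a * m + j * g) (suc ((a + 2 * j) * m)) (diagonal a j)
  diagonal-increasing a zero _ =
    increasingIn-widen (≤-reflexive a*m≡) ≤-refl (point-increasing (a + 0))
    where
    a*m≡ : a * m + 0 * g ≡ (a + 0) * m
    a*m≡ = solve (a ∷ m ∷ g ∷ [])
  diagonal-increasing a (suc j) 3+j≤d =
    increasingIn-++ (trade-upper a (suc j)) (n≤1+n _)
      (increasingIn-widen ≤-refl stairs≤top (stairs-increasing a j (≤-trans (n≤1+n _) 3+j≤d)))
      (point-increasing (a + 2 * suc j))
    where
    stairs≤top : (a + 2 * j) * m + g + 2 ≤ (a + 2 * suc j) * m
    stairs≤top = begin
      (a + 2 * j) * m + g + 2           ≡⟨ solve (a ∷ j ∷ m ∷ g ∷ []) ⟩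
      (a + 2 * j) * m + 1 * g + 2       ≤⟨ block-gap (a + 2 * j) 0 (≤-trans (s≤s (s≤s z≤n)) 3+j≤d) ⟩
      (2 + (a + 2 * j)) * m + 0 * g     ≡⟨ solve (a ∷ j ∷ m ∷ g ∷ []) ⟩
      (a + 2 * suc j) * m               ∎
      where open ≤-Reasoning

  levels-increasing : ∀ q → suc q ≤ d → q * d < m → IncreasingIn 0 (q * g) (levels q)
  levels-increasing zero    _ _ = AllPairs.[] , All.[]
  levels-increasing (suc q) 2+q≤d [1+q]d<m =
    increasingIn-++ z≤n (*-monoˡ-≤ g (n≤1+n q))
      (levels-increasing q (≤-trans (n≤1+n _) 2+q≤d) (≤-<-trans (m≤n+m (q * d) d) [1+q]d<m))
      (increasingIn-widen ≤-refl odd-diagonal≤next-level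
        (increasingIn-++ (m≤n+m (q * g) (1 * m)) (≤-trans (trade-upper 1 q) (n≤1+n _))
          (increasingIn-widen ≤-refl even-diagonal≤odd-diagonal (diagonal-increasing 0 q 2+q≤d))
          (diagonal-increasing 1 q 2+q≤d)))
    where
    [1+q]d<1*m : suc q * d < 1 * m
    [1+q]d<1*m = <-≤-trans [1+q]d<m (≤-reflexive (sym (*-identityˡ m)))
    even-diagonal≤odd-diagonal : suc ((2 * q) * m) ≤ 1 * m + q * g
    even-diagonal≤odd-diagonal =
      trade-lower-strict 1 q (2 * q) 1 (+-comm 1 (2 * q)) (≤-<-trans (m≤n+m (q * d) d) [1+q]d<1*m)
    odd-diagonal≤next-level : suc ((1 + 2 * q) * m) ≤ suc q * g
    odd-diagonal≤next-level = trade-lower-strict 0 (suc q) (1 + 2 * q) 1 2+2q≡[1+2q]+1 [1+q]d<1*m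
      where
      2+2q≡[1+2q]+1 : 0 + 2 * suc q ≡ (1 + 2 * q) + 1
      2+2q≡[1+2q]+1 = solve (q ∷ [])

parity-split : ∀ a → ∃ λ r → ∃ λ u → r ≤ 1 × a ≡ r + 2 * u
parity-split a = a % 2 , a / 2 , s≤s⁻¹ (m%n<n a 2) ,
  trans (m≡m%n+[m/n]*n a 2) (cong (a % 2 +_) (*-comm (a / 2) 2))

conductor-by-gap : ∀ {P : ℕ → Set} {t c} → (∀ n → t ≤ n → P n) → ¬ P (pred t) →
                   IsConductor P c → c ≡ t
conductor-by-gap above-t pred-t∉P (above-c , least) =
  ≤-antisym (least _ above-t) (≮⇒≥ λ c<t → pred-t∉P (above-c _ (<⇒≤pred c<t)))

-- Here k + 1 plays the role of p / 2; for S(p) itself d = p / 2 + 4.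
module LeftElements {m g d k : ℕ} (g+d≡2m : g + d ≡ 2 * m) (k+3≤d : 2 + suc k ≤ d)
                    ([1+k]d<m : suc k * d < m) where
  open Staircase m g
  open Interleaving {m} {g} {d} g+d≡2m

  t : ℕ
  t = 2 * suc k * m

  S : ℕ → Set
  S = InGenT (generators m g) t

  leftList : List ℕ
  leftList = levels (suc k) ++ stairs 0 (suc k)

  top : ℕ
  top = 2 * k * m + g + 2

  leftList-increasing : IncreasingIn 0 top leftList
  leftList-increasing =
    increasingIn-++ z≤n (increasingIn-bounds last-stairs)
      (levels-increasing (suc k) (≤-trans (n≤1+n _) k+3≤d) [1+k]d<m) last-stairs
    where
    last-stairs : IncreasingIn (suc k * g) top (stairs 0 (suc k))
    last-stairs = stairs-increasing 0 k (≤-trans (n≤1+n _) k+3≤d)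

  top<t : top < t
  top<t = begin-strict
    2 * k * m + g + 2          <⟨ n<1+n _ ⟩
    suc (2 * k * m + g + 2)    ≡⟨ solve (k ∷ m ∷ g ∷ []) ⟩
    2 * k * m + 1 * g + 3      ≤⟨ block-gap (2 * k) 0 (≤-trans (s≤s (s≤s (s≤s z≤n))) k+3≤d) ⟩
    (2 + 2 * k) * m + 0 * g    ≡⟨ solve (k ∷ m ∷ g ∷ []) ⟩
    2 * suc k * m              ∎
    where open ≤-Reasoning

  d≤m : d ≤ m
  d≤m = ≤-trans (m≤m+n d (k * d)) (<⇒≤ [1+k]d<m)

  large-j⇒t≤ : ∀ a {j} e → 2 + k ≤ j → t ≤ a * m + j * g + e
  large-j⇒t≤ a {j} e 2+k≤j = begin
    t                      ≤⟨ trade-lower 0 (2 + k) (2 * suc k) 2 4+2k≡[2+2k]+2 [2+k]d≤2m ⟩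
    (2 + k) * g            ≤⟨ *-monoˡ-≤ g 2+k≤j ⟩
    j * g                  ≤⟨ m≤n+m _ _ ⟩
    a * m + j * g          ≤⟨ m≤m+n _ _ ⟩
    a * m + j * g + e      ∎
    where
    open ≤-Reasoning
    4+2k≡[2+2k]+2 : 0 + 2 * (2 + k) ≡ 2 * suc k + 2
    4+2k≡[2+2k]+2 = solve (k ∷ [])
    [2+k]d≤2m : (2 + k) * d ≤ 2 * m
    [2+k]d≤2m = begin
      d + suc k * d  ≤⟨ +-mono-≤ d≤m (<⇒≤ [1+k]d<m) ⟩
      m + m          ≡⟨ solve (m ∷ []) ⟩
      2 * m          ∎

  high-level⇒t≤ : ∀ a j e → j ≤ suc k → suc (2 * suc k) ≤ a + 2 * j → t ≤ a * m + j * g + e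
  high-level⇒t≤ a j e j≤1+k 2k+3≤a+2j with m≤n⇒∃[o]m+o≡n 2k+3≤a+2j
  ... | o , 2k+3+o≡a+2j =
    ≤-trans (trade-lower a j (2 * suc k) (suc o) a+2j≡2+2k+[1+o] jd≤[1+o]m) (m≤m+n _ e)
    where
    a+2j≡2+2k+[1+o] : a + 2 * j ≡ 2 * suc k + suc o
    a+2j≡2+2k+[1+o] = trans (sym 2k+3+o≡a+2j) (sym (+-suc _ o))
    jd≤[1+o]m : j * d ≤ suc o * m
    jd≤[1+o]m = ≤-trans (*-monoˡ-≤ d j≤1+k) (≤-trans (<⇒≤ [1+k]d<m) (m≤m+n m (o * m)))

  on-last-level : ∀ u j {e} → u + j ≡ suc k → e ≤ j → (2 * u) * m + j * g + e < t →
                  (2 * u) * m + j * g + e ∈ stairs 0 (suc k)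
  on-last-level u zero u+0≡1+k z≤n n<t =
    ⊥-elim (<-irrefl n≡t n<t)
    where
    open ≡-Reasoning
    n≡t : 2 * u * m + 0 * g + 0 ≡ 2 * suc k * m
    n≡t = begin
      2 * u * m + 0 * g + 0  ≡⟨ solve (u ∷ m ∷ g ∷ []) ⟩
      2 * (u + 0) * m        ≡⟨ cong (λ v → 2 * v * m) u+0≡1+k ⟩
      2 * suc k * m          ∎
  on-last-level u (suc j) {e} u+j≡1+k e≤j _ =
    subst (λ s → 2 * u * m + suc j * g + e ∈ stairs 0 s) u+j≡1+k (∈-stairs 0 u e≤j)

  beyond-levels : ∀ r u j → suc k ≤ u + j → r + 2 * u + 2 * j ≤ 2 * suc k → r ≡ 0 × u + j ≡ suc k
  beyond-levels r u j 1+k≤u+j r+2u+2j≤2+2k =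
    n≤0⇒n≡0 (+-cancelʳ-≤ (2 * (u + j)) r 0 (≤-trans r+2[u+j]≤2+2k (*-monoʳ-≤ 2 1+k≤u+j))) ,
    ≤-antisym (*-cancelˡ-≤ 2 (≤-trans (m≤n+m _ r) r+2[u+j]≤2+2k)) 1+k≤u+j
    where
    r+2[u+j]≤2+2k : r + 2 * (u + j) ≤ 2 * suc k
    r+2[u+j]≤2+2k = ≤-trans (≤-reflexive regroup) r+2u+2j≤2+2k
      where
      regroup : r + 2 * (u + j) ≡ r + 2 * u + 2 * j
      regroup = solve (r ∷ u ∷ j ∷ [])

  leftList-complete : ∀ {n} → Decomposition m g n → n < t → n ∈ leftList
  leftList-complete (decomposition a j e e≤j refl) n<t with j ≤? suc k
  ... | no j≰1+k = ⊥-elim (<⇒≱ n<t (large-j⇒t≤ a e (≰⇒> j≰1+k)))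
  ... | yes j≤1+k with a + 2 * j ≤? 2 * suc k
  ... | no a+2j≰2+2k = ⊥-elim (<⇒≱ n<t (high-level⇒t≤ a j e j≤1+k (≰⇒> a+2j≰2+2k)))
  ... | yes a+2j≤2+2k with parity-split a
  ... | r , u , r≤1 , refl with u + j <? suc k
  ... | yes u+j<1+k = ∈-++⁺ˡ (∈-levels (suc k) u j r≤1 e≤j u+j<1+k)
  ... | no u+j≮1+k with beyond-levels r u j (≮⇒≥ u+j≮1+k) a+2j≤2+2k
  ... | refl , u+j≡1+k = ∈-++⁺ʳ (levels (suc k)) (on-last-level u j u+j≡1+k e≤j n<t)

  leftList-decomposed : All (Decomposition m g) leftList
  leftList-decomposed = Allₚ.++⁺ (levels-decomposed (suc k)) (stairs-decomposed 0 (suc k))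

  leftList-bounded : ∀ {x} → x ∈ leftList → x < top
  leftList-bounded x∈ = proj₂ (All.lookup (proj₂ leftList-increasing) x∈)

  no-element-in-gap : ∀ {x} → top ≤ x → x < t → ¬ S x
  no-element-in-gap top≤x x<t (inj₁ t≤x) = <⇒≱ x<t t≤x
  no-element-in-gap top≤x x<t (inj₂ x∈S) =
    <⇒≱ (leftList-bounded (leftList-complete (InMonoid⇒Decomposition x∈S) x<t)) top≤x

  conductor : ∀ {c} → IsConductor S c → c ≡ t
  conductor = conductor-by-gap (λ _ → inj₁) (no-element-in-gap (<⇒≤pred top<t) pred-t<t)
    where
    pred-t<t : pred t < t
    pred-t<t = ≤-reflexive (suc-pred t {{>-nonZero (≤-<-trans z≤n top<t)}})

  leftList-card : HasCard (IsLeft S t) (length leftList)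
  leftList-card = leftList , AllPairs.map <⇒≢ (proj₁ leftList-increasing) ,
                  (λ n → mk⇔ (sound n) (complete n)) , refl
    where
    sound : ∀ n → n ∈ leftList → IsLeft S t n
    sound n n∈ = inj₂ (Decomposition⇒InMonoid (All.lookup leftList-decomposed n∈)) ,
                 <-trans (leftList-bounded n∈) top<t
    complete : ∀ n → IsLeft S t n → n ∈ leftList
    complete n (inj₁ t≤n , n<t) = ⊥-elim (<⇒≱ n<t t≤n)
    complete n (inj₂ n∈S , n<t) = leftList-complete (InMonoid⇒Decomposition n∈S) n<t

  leftList-length : 6 * length leftList ≡
                    2 * (suc k * (1 + suc k) * (2 + suc k)) + 3 * (suc k * (3 + suc k))
  leftList-length = begin
    6 * length (levels (suc k) ++ stairs 0 (suc k))
      ≡⟨ cong (6 *_) (length-++ (levels (suc k))) ⟩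
    6 * (length (levels (suc k)) + length (stairs 0 (suc k)))
      ≡⟨ regroup (length (levels (suc k))) (length (stairs 0 (suc k))) ⟩
    2 * (3 * length (levels (suc k))) + 3 * (2 * length (stairs 0 (suc k)))
      ≡⟨ cong₂ (λ x y → 2 * x + 3 * y) (levels-length (suc k)) (stairs-length 0 (suc k)) ⟩
    2 * (suc k * (1 + suc k) * (2 + suc k)) + 3 * (suc k * (3 + suc k)) ∎
    where
    open ≡-Reasoning
    regroup : ∀ x y → 6 * (x + y) ≡ 2 * (3 * x) + 3 * (2 * y)
    regroup x y = solve (x ∷ y ∷ [])

  left-elements : ∀ c → IsConductor S c → Σ ℕ λ N →
    HasCard (IsLeft S c) N × 6 * N ≡ 2 * (suc k * (1 + suc k) * (2 + suc k)) + 3 * (suc k * (3 + suc k))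
  left-elements c isConductor rewrite conductor isConductor =
    length leftList , leftList-card , leftList-length

γ+[k+4]≡2μ : ∀ k → γ' (2 * k) k + (k + 4) ≡ 2 * μ' (2 * k) k
γ+[k+4]≡2μ k = m∸n+n≡m (begin
  k + 4                             ≤⟨ m≤n+m (k + 4) (2 * (k * k) + 7 * k) ⟩
  2 * (k * k) + 7 * k + (k + 4)     ≡⟨ solve (k ∷ []) ⟩
  2 * (k * k + 2 * (2 * k) + 2)     ∎)
  where open ≤-Reasoning

k[k+4]<μ : ∀ k → k * (k + 4) < μ' (2 * k) k
k[k+4]<μ k = <-≤-trans (m<m+n (k * (k + 4)) {2} z<s) (≤-reflexive μ≡)
  where
  μ≡ : k * (k + 4) + 2 ≡ k * k + 2 * (2 * k) + 2
  μ≡ = solve (k ∷ [])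

count-in-terms-of-p : ∀ K N → 6 * N ≡ 2 * (K * (1 + K) * (2 + K)) + 3 * (K * (3 + K)) →
                      24 * N ≡ (2 * K) ^ 3 + 9 * (2 * K) ^ 2 + 26 * (2 * K)
count-in-terms-of-p K N 6N≡ = begin
  24 * N                                                  ≡⟨ solve (N ∷ []) ⟩
  4 * (6 * N)                                             ≡⟨ cong (4 *_) 6N≡ ⟩
  4 * (2 * (K * (1 + K) * (2 + K)) + 3 * (K * (3 + K)))   ≡⟨ solve (K ∷ []) ⟩
  2 * K * (2 * K * (2 * K * 1)) + 9 * (2 * K * (2 * K * 1)) + 26 * (2 * K) ∎
  where open ≡-Reasoning

corollary3p17 : ∀ (p k : ℕ) → p ≡ 2 * k → 0 < p → ∀ (c : ℕ) →
    IsConductor (InSp p k) c →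
    Σ ℕ (λ N → HasCard (IsLeft (InSp p k) c) N × (24 * N ≡ p ^ 3 + 9 * p ^ 2 + 26 * p))
corollary3p17 .(2 * zero)  zero    refl ()
corollary3p17 .(2 * suc k) (suc k) refl _ c isConductor =
  let N , card , count = LeftElements.left-elements (γ+[k+4]≡2μ (suc k)) k+3≤k+5 (k[k+4]<μ (suc k))
                           c isConductor
  in N , card , count-in-terms-of-p (suc k) N count
  where
  k+3≤k+5 : 2 + suc k ≤ suc k + 4
  k+3≤k+5 = ≤-trans (≤-reflexive (+-comm 2 (suc k))) (+-monoʳ-≤ (suc k) (s≤s (s≤s z≤n)))
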